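{- The inequality $\sum_{a \in \check{A}}y_a \geq \sum_{a \in \delta^+(0)}y_a$ is valid for $\mathcal{P}$.
   Context: Let $G=(V,A)$ be a DAG with $V=\{1,\dots,n\}$ and $\check{A}\subseteq A$. Let $\bar{G}=(\bar V,\bar A)$ with $\bar V=\{0\}\cup V\cup\{\bar n\}$, $\bar n=n+1$, and $\bar A=\{(0,i):i\in V\}\cup A\cup\{(i,\bar n):i\in V\}$. For $S\subseteq\bar V$, $\delta^+(S)$ (resp. $\delta^-(S)$) denotes the arcs of $\bar A$ leaving (resp. entering) $S$. A path $(v_0=0,v_1,\dots,v_h,v_{h+1}=\bar n)$ in $\bar G$ is feasible if it traverses at least one arc of $\check{A}$, and infeasible otherwise. $\mathcal{P}$ is the convex hull of all binary vectors $y\in\{0,1\}^{|\bar A|}$ satisfying $\sum_{a\in\delta^-(i)}y_a\le 1$ and $\sum_{a\in\delta^-(i)}y_a=\sum_{a\in\delta^+(i)}y_a$ for all $i\in V$, and $\sum_{i=0}^h y_{(v_i,v_{i+1})}\le h$ for every infeasible path $(v_0=0,v_1,\dots,v_h,v_{h+1}=\bar n)$.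
   Formalization: The inequality is asserted only at points of 𝒫 with rational coordinates that are rational convex combinations of the feasible binary vectors, rather than at all real points of the convex hull. -}

module Defs where

open import Data.Bool using (Bool; true; false; T; if_then_else_; not)
open import Data.Nat using (ℕ; zero; suc)
open import Data.Fin using (Fin; _≟_)
open import Data.List using (List; []; _∷_; _++_; map; concatMap; foldr; length)
open import Data.List.Relation.Unary.All using (All)
open import Data.Product using (Σ; _×_; _,_; ∃; proj₁; proj₂)
open import Data.Rational using (ℚ; 0ℚ; 1ℚ; _+_; _*_; _≤_)
open import Relation.Nullary using (¬_; yes; no; does)
open import Relation.Nullary.Decidable using (T?)
open import Relation.Binary.PropositionalEquality using (_≡_)
import Data.Nat as ℕ
import Data.List as L

-- Digraph G = (V, A) with V = {1,…,n}, encoded as Fin n (vertex i of the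
-- paper is the element (i-1) of Fin n).  The arc set A is given by a
-- Boolean adjacency relation; Ǎ likewise.

Rel : ℕ → Set
Rel n = Fin n → Fin n → Bool

data Chain {n : ℕ} (A : Rel n) : Fin n → Fin n → Set where
  single : (i : Fin n) → Chain A i i
  step   : {i j k : Fin n} → T (A i j) → Chain A j k → Chain A i k

Acyclic : {n : ℕ} → Rel n → Set
Acyclic {n} A = (i j : Fin n) → T (A i j) → ¬ Chain A j i

_⊆ᴬ_ : {n : ℕ} → Rel n → Rel n → Set
_⊆ᴬ_ {n} B A = (i j : Fin n) → T (B i j) → T (A i j)

-- The extended graph Ḡ: nodes 0, V, n̄ and arcs Ā.

data Node (n : ℕ) : Set where
  source : Node n
  vtx    : Fin n → Node n
  sink   : Node n

data BArc {n : ℕ} (A : Rel n) : Set where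
  out0 : Fin n → BArc A
  arc  : (i j : Fin n) → T (A i j) → BArc A
  inN  : Fin n → BArc A

module _ {n : ℕ} {A : Rel n} where

  tailN : BArc A → Node n
  tailN (out0 i)    = source
  tailN (arc i j _) = vtx i
  tailN (inN i)     = vtx i

  headN : BArc A → Node n
  headN (out0 i)    = vtx i
  headN (arc i j _) = vtx j
  headN (inN i)     = sink

  isV : Fin n → Node n → Bool
  isV i (vtx j) = does (i ≟ j)
  isV i _       = false

  isSource : Node n → Bool
  isSource source = true
  isSource _      = false

  inCheck : Rel n → BArc A → Bool
  inCheck B (arc i j _) = B i j
  inCheck B _           = false

  inDeltaMinus : Fin n → BArc A → Bool
  inDeltaMinus i a = isV i (headN a)

  inDeltaPlus : Fin n → BArc A → Bool
  inDeltaPlus i a = isV i (tailN a)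

  inDeltaPlus0 : BArc A → Bool
  inDeltaPlus0 a = isSource (tailN a)

allFin : (n : ℕ) → List (Fin n)
allFin n = L.allFin n

arcIf : {n : ℕ} (A : Rel n) (i j : Fin n) → List (BArc A)
arcIf A i j with T? (A i j)
... | yes p = arc i j p ∷ []
... | no _  = []

allArcs : {n : ℕ} (A : Rel n) → List (BArc A)
allArcs {n} A =
  map out0 (allFin n)
  ++ concatMap (λ i → concatMap (λ j → arcIf A i j) (allFin n)) (allFin n)
  ++ map inN (allFin n)

sumℕ : List ℕ → ℕ
sumℕ = foldr ℕ._+_ 0

sumℚ : List ℚ → ℚ
sumℚ = foldr _+_ 0ℚ

ΣArcsℕ : {n : ℕ} (A : Rel n) → (BArc A → Bool) → (BArc A → ℕ) → ℕ
ΣArcsℕ A P f = sumℕ (map (λ a → if P a then f a else 0) (allArcs A))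

ΣArcsℚ : {n : ℕ} (A : Rel n) → (BArc A → Bool) → (BArc A → ℚ) → ℚ
ΣArcsℚ A P f = sumℚ (map (λ a → if P a then f a else 0ℚ) (allArcs A))

BinVec : {n : ℕ} → Rel n → Set
BinVec A = BArc A → Bool

bitℕ : Bool → ℕ
bitℕ true  = 1
bitℕ false = 0

bitℚ : Bool → ℚ
bitℚ true  = 1ℚ
bitℚ false = 0ℚ

-- Arcs of the Ḡ-path (0, v₁, …, v_h, n̄) whose inner part is the chain c
-- from v₁ to v_h in G.
chainArcs : {n : ℕ} {A : Rel n} {i k : Fin n} → Chain A i k → List (BArc A)
chainArcs (single i) = []
chainArcs (step {i} {j} p c) = arc i j p ∷ chainArcs c

pathArcs : {n : ℕ} {A : Rel n} {i k : Fin n} → Chain A i k → List (BArc A)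
pathArcs {i = i} {k = k} c = out0 i ∷ chainArcs c ++ inN k ∷ []

-- h = number of inner vertices v₁,…,v_h of the path
innerCount : {n : ℕ} {A : Rel n} {i k : Fin n} → Chain A i k → ℕ
innerCount (single i) = 1
innerCount (step p c) = suc (innerCount c)

Infeasible : {n : ℕ} {A : Rel n} (B : Rel n) {i k : Fin n} → Chain A i k → Set
Infeasible B c = All (λ a → inCheck B a ≡ false) (pathArcs c)

record Feasible {n : ℕ} (A B : Rel n) (y : BinVec A) : Set where
  field
    inflow≤1 : (i : Fin n) → ΣArcsℕ A (inDeltaMinus i) (λ a → bitℕ (y a)) ℕ.≤ 1
    flowCons : (i : Fin n) →
      ΣArcsℕ A (inDeltaMinus i) (λ a → bitℕ (y a))
        ≡ ΣArcsℕ A (inDeltaPlus i) (λ a → bitℕ (y a))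
    infeasPath : {i k : Fin n} (c : Chain A i k) → Infeasible B c →
      sumℕ (map (λ a → bitℕ (y a)) (pathArcs c)) ℕ.≤ innerCount c

-- 𝒫 = conv(feasible binary vectors), here with rational convex
-- combinations: y = Σ_k λ_k x_k with λ_k ≥ 0, Σ_k λ_k = 1, x_k feasible.
InP : {n : ℕ} (A B : Rel n) → (BArc A → ℚ) → Set
InP A B y =
  Σ (List (ℚ × BinVec A)) λ comb →
    All (λ p → (0ℚ ≤ proj₁ p) × Feasible A B (proj₂ p)) comb
    × sumℚ (map proj₁ comb) ≡ 1ℚ
    × ((a : BArc A) →
         y a ≡ sumℚ (map (λ p → proj₁ p * bitℚ (proj₂ p a)) comb))

{-# OPTIONS --safe #-}
-- Let y be an integral point of 𝒫 and U the set of vertices reachable from 0 along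
-- selected arcs (y_a = 1) outside Ǎ. Summing flow conservation over U shows that the y-flow on
-- arcs with tail in U equals the y-flow on arcs with head in U. Arc by arc,
--   [a ∈ δ⁺(0)] y_a + [tail a ∈ U] y_a ≤ [a ∈ Ǎ] y_a + [head a ∈ U] y_a,
-- because a selected arc leaving 0, or leaving U outside Ǎ, has its head in U, and no
-- selected arc goes from U to n̄: that would complete an infeasible path all of whose
-- h + 1 arcs are selected. Summing over all arcs gives the inequality for y. For an
-- arbitrary point of 𝒫 the inequality, being linear and homogeneous, survives
-- nonnegative combinations of integral points.
module Submission where

open import Defs
open import Data.Nat using (ℕ)
open import Data.Rational using (ℚ; _≤_)

open import Algebra.Bundles using (CommutativeMonoid)
open import Data.Bool using (Bool; true; false; if_then_else_; T)
open import Data.Empty using (⊥; ⊥-elim)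
open import Data.Fin using (Fin; zero; suc; _≟_)
open import Data.List using (List; []; _∷_; map; foldr; length)
open import Data.List.Properties using (map-tabulate)
open import Data.List.Relation.Unary.All as All using (All; []; _∷_)
open import Data.List.Relation.Unary.All.Properties using (++⁺)
open import Data.Product using (_×_; _,_; proj₁; proj₂)
open import Function using (_∘_; id)
open import Level using (0ℓ)
open import Relation.Binary.Core using (_Preserves₂_⟶_⟶_)
open import Relation.Binary.PropositionalEquality using (_≡_; refl; sym; trans; cong; cong₂; subst; subst₂; module ≡-Reasoning)
open import Relation.Nullary using (¬_; yes; no; does)
open import Relation.Nullary.Decidable using (decidable-stable; ¬¬-excluded-middle)
open import Relation.Nullary.Negation using (¬¬-map)
open import Relation.Unary using (Pred; Decidable)
import Algebra.Properties.Monoid.Mult as MonoidMult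
import Data.Nat as ℕ
import Data.Nat.Properties as ℕ
import Data.Rational as ℚ
import Data.Rational.Properties as ℚ

module ListSum (M : CommutativeMonoid 0ℓ 0ℓ) where
  open CommutativeMonoid M renaming (refl to ≈-refl; sym to ≈-sym; trans to ≈-trans)
  open import Algebra.Properties.CommutativeSemigroup commutativeSemigroup using (interchange)

  ∑ : {X : Set} → (X → Carrier) → List X → Carrier
  ∑ f xs = foldr _∙_ ε (map f xs)

  infixr 9 [_]_
  [_]_ : Bool → Carrier → Carrier
  [ b ] x = if b then x else ε

  []-ε : ∀ b → [ b ] ε ≈ ε
  []-ε true  = ≈-refl
  []-ε false = ≈-refl

  []-comm : ∀ b c x → [ b ] [ c ] x ≈ [ c ] [ b ] x
  []-comm true  c x = ≈-refl
  []-comm false c x = ≈-sym ([]-ε c)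

  ∑-cong : ∀ {X} {f g : X → Carrier} xs → (∀ x → f x ≈ g x) → ∑ f xs ≈ ∑ g xs
  ∑-cong []       f≈g = ≈-refl
  ∑-cong (x ∷ xs) f≈g = ∙-cong (f≈g x) (∑-cong xs f≈g)

  ∑-ε : ∀ {X} (xs : List X) → ∑ (λ _ → ε) xs ≈ ε
  ∑-ε []       = ≈-refl
  ∑-ε (x ∷ xs) = ≈-trans (identityˡ _) (∑-ε xs)

  ∑-distrib : ∀ {X} (f g : X → Carrier) xs → ∑ (λ x → f x ∙ g x) xs ≈ ∑ f xs ∙ ∑ g xs
  ∑-distrib f g []       = ≈-sym (identityˡ ε)
  ∑-distrib f g (x ∷ xs) =
    ≈-trans (∙-congˡ (∑-distrib f g xs)) (interchange (f x) (g x) (∑ f xs) (∑ g xs))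

  ∑-comm : ∀ {X Y} (h : X → Y → Carrier) xs ys →
           ∑ (λ x → ∑ (h x) ys) xs ≈ ∑ (λ y → ∑ (λ x → h x y) xs) ys
  ∑-comm h []       ys = ≈-sym (∑-ε ys)
  ∑-comm h (x ∷ xs) ys =
    ≈-trans (∙-congˡ (∑-comm h xs ys)) (≈-sym (∑-distrib (h x) (λ y → ∑ (λ x → h x y) xs) ys))

  ∑-[] : ∀ {X} b (f : X → Carrier) xs → ∑ (λ x → [ b ] f x) xs ≈ [ b ] ∑ f xs
  ∑-[] true  f xs = ≈-refl
  ∑-[] false f xs = ∑-ε xs

  ∑-allFin-suc : ∀ {n} (f : Fin (ℕ.suc n) → Carrier) →
                 ∑ f (allFin (ℕ.suc n)) ≈ f zero ∙ ∑ (f ∘ suc) (allFin n)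
  ∑-allFin-suc f = ∙-congˡ (reflexive (cong (foldr _∙_ ε)
    (trans (map-tabulate suc f) (sym (map-tabulate id (f ∘ suc))))))

  ∑-allFin-select : ∀ {n} (g : Fin n → Carrier) w →
                    ∑ (λ v → [ does (v ≟ w) ] g v) (allFin n) ≈ g w
  ∑-allFin-select {ℕ.suc n} g zero =
    ≈-trans (∑-allFin-suc (λ v → [ does (v ≟ zero) ] g v))
            (≈-trans (∙-congˡ (∑-ε (allFin n))) (identityʳ (g zero)))
  ∑-allFin-select {ℕ.suc n} g (suc w) =
    ≈-trans (∑-allFin-suc (λ v → [ does (v ≟ suc w) ] g v))
            (≈-trans (identityˡ _) (∑-allFin-select (g ∘ suc) w))

  module _ {ℓ} (_≤ᶜ_ : Carrier → Carrier → Set ℓ)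
           (ε≤ε : ε ≤ᶜ ε) (∙-mono : _∙_ Preserves₂ _≤ᶜ_ ⟶ _≤ᶜ_ ⟶ _≤ᶜ_) where

    ∑-mono : ∀ {X} {f g : X → Carrier} {xs} → All (λ x → f x ≤ᶜ g x) xs → ∑ f xs ≤ᶜ ∑ g xs
    ∑-mono []           = ε≤ε
    ∑-mono (fx≤gx ∷ le) = ∙-mono fx≤gx (∑-mono le)

module ℕ∑ = ListSum ℕ.+-0-commutativeMonoid
module ℚ∑ = ListSum ℚ.+-0-commutativeMonoid

module _ where
  open ℚ∑

  ∑-*-distribˡ : {X : Set} (c : ℚ) (f : X → ℚ) (xs : List X) →
                 ∑ (λ x → c ℚ.* f x) xs ≡ c ℚ.* ∑ f xs
  ∑-*-distribˡ c f []       = sym (ℚ.*-zeroʳ c)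
  ∑-*-distribˡ c f (x ∷ xs) =
    trans (cong (c ℚ.* f x ℚ.+_) (∑-*-distribˡ c f xs)) (sym (ℚ.*-distribˡ-+ c (f x) (∑ f xs)))

  []-* : ∀ b c x → [ b ] (c ℚ.* x) ≡ c ℚ.* [ b ] x
  []-* true  c x = refl
  []-* false c x = sym (ℚ.*-zeroʳ c)

  ∑-[]-combination : {X K : Set} (P : X → Bool) (c : K → ℚ) (f : K → X → ℚ)
                     (xs : List X) (ks : List K) →
    ∑ (λ x → [ P x ] ∑ (λ k → c k ℚ.* f k x) ks) xs
      ≡ ∑ (λ k → c k ℚ.* ∑ (λ x → [ P x ] f k x) xs) ks
  ∑-[]-combination P c f xs ks = begin
    ∑ (λ x → [ P x ] ∑ (λ k → c k ℚ.* f k x) ks) xs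
      ≡⟨ ∑-cong xs (λ x → sym (∑-[] (P x) (λ k → c k ℚ.* f k x) ks)) ⟩
    ∑ (λ x → ∑ (λ k → [ P x ] (c k ℚ.* f k x)) ks) xs
      ≡⟨ ∑-comm (λ x k → [ P x ] (c k ℚ.* f k x)) xs ks ⟩
    ∑ (λ k → ∑ (λ x → [ P x ] (c k ℚ.* f k x)) xs) ks
      ≡⟨ ∑-cong ks (λ k → trans (∑-cong xs (λ x → []-* (P x) (c k) (f k x)))
                                (∑-*-distribˡ (c k) (λ x → [ P x ] f k x) xs)) ⟩
    ∑ (λ k → c k ℚ.* ∑ (λ x → [ P x ] f k x) xs) ks ∎
    where open ≡-Reasoning

  ∑-nonNeg-*-mono-≤ : {K : Set} {c f g : K → ℚ} {ks : List K} →
    All (λ k → ℚ.0ℚ ≤ c k × f k ≤ g k) ks →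
    ∑ (λ k → c k ℚ.* f k) ks ≤ ∑ (λ k → c k ℚ.* g k) ks
  ∑-nonNeg-*-mono-≤ {c = c} {ks = ks} bounds =
    ∑-mono _≤_ (ℚ.≤-refl {ℚ.0ℚ}) ℚ.+-mono-≤ {xs = ks}
      (All.map (λ {k} (c≥0 , f≤g) → ℚ.*-monoˡ-≤-nonNeg (c k) {{ℚ.nonNegative c≥0}} f≤g) bounds)

open MonoidMult ℚ.+-0-monoid using (×-homo-1; ×-homo-+) renaming (_×_ to _×ℚ_)

fromℕ : ℕ → ℚ
fromℕ m = m ×ℚ ℚ.1ℚ

fromℕ-nonNeg : ∀ m → ℚ.0ℚ ≤ fromℕ m
fromℕ-nonNeg ℕ.zero    = ℚ.≤-refl
fromℕ-nonNeg (ℕ.suc m) = ℚ.+-mono-≤ (ℚ.nonNegative⁻¹ ℚ.1ℚ) (fromℕ-nonNeg m)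

fromℕ-mono-≤ : ∀ {m k} → m ℕ.≤ k → fromℕ m ≤ fromℕ k
fromℕ-mono-≤ {k = k} ℕ.z≤n = fromℕ-nonNeg k
fromℕ-mono-≤ (ℕ.s≤s m≤k) = ℚ.+-monoʳ-≤ ℚ.1ℚ (fromℕ-mono-≤ m≤k)

∑-fromℕ : {X : Set} (f : X → ℕ) (xs : List X) → ℚ∑.∑ (fromℕ ∘ f) xs ≡ fromℕ (ℕ∑.∑ f xs)
∑-fromℕ f []       = refl
∑-fromℕ f (x ∷ xs) =
  trans (cong (fromℕ (f x) ℚ.+_) (∑-fromℕ f xs)) (sym (×-homo-+ ℚ.1ℚ (f x) (ℕ∑.∑ f xs)))

[]-bitℚ : ∀ b c → ℚ∑.[ b ] bitℚ c ≡ fromℕ (ℕ∑.[ b ] bitℕ c)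
[]-bitℚ true  true  = sym (×-homo-1 ℚ.1ℚ)
[]-bitℚ true  false = refl
[]-bitℚ false c     = refl

¬¬-decidable-Fin : ∀ {n ℓ} (P : Pred (Fin n) ℓ) → ¬ ¬ Decidable P
¬¬-decidable-Fin {ℕ.zero}  P k = k (λ ())
¬¬-decidable-Fin {ℕ.suc n} P k =
  ¬¬-excluded-middle λ P₀? → ¬¬-decidable-Fin (P ∘ suc) λ P₊? →
    k λ { zero → P₀? ; (suc v) → P₊? v }

FlowConserved : {n : ℕ} {A : Rel n} → (BArc A → ℕ) → Set
FlowConserved {n} {A} e =
  (i : Fin n) → ΣArcsℕ A (inDeltaMinus i) e ≡ ΣArcsℕ A (inDeltaPlus i) e

nodeIn : {n : ℕ} → (Fin n → Bool) → Node n → Bool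
nodeIn U (vtx v) = U v
nodeIn U _       = false

module Cut {n : ℕ} {A : Rel n} where
  open ℕ∑

  private
    isVᴬ : Fin n → Node n → Bool
    isVᴬ = isV {A = A}

  ∑-isV : (U : Fin n → Bool) (x : Node n) (c : ℕ) →
          ∑ (λ v → [ U v ] [ isVᴬ v x ] c) (allFin n) ≡ [ nodeIn U x ] c
  ∑-isV U source  c = trans (∑-cong (allFin n) (λ v → []-ε (U v))) (∑-ε (allFin n))
  ∑-isV U sink    c = trans (∑-cong (allFin n) (λ v → []-ε (U v))) (∑-ε (allFin n))
  ∑-isV U (vtx w) c = trans (∑-cong (allFin n) (λ v → []-comm (U v) (does (v ≟ w)) c))
                            (∑-allFin-select (λ v → [ U v ] c) w)

  ∑-nodeIn : (U : Fin n → Bool) (φ : BArc A → Node n) (e : BArc A → ℕ) →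
             ∑ (λ a → [ nodeIn U (φ a) ] e a) (allArcs A)
               ≡ ∑ (λ v → [ U v ] ∑ (λ a → [ isVᴬ v (φ a) ] e a) (allArcs A)) (allFin n)
  ∑-nodeIn U φ e = begin
    ∑ (λ a → [ nodeIn U (φ a) ] e a) arcs
      ≡⟨ ∑-cong arcs (λ a → sym (∑-isV U (φ a) (e a))) ⟩
    ∑ (λ a → ∑ (λ v → [ U v ] [ isVᴬ v (φ a) ] e a) (allFin n)) arcs
      ≡⟨ ∑-comm (λ a v → [ U v ] [ isVᴬ v (φ a) ] e a) arcs (allFin n) ⟩
    ∑ (λ v → ∑ (λ a → [ U v ] [ isVᴬ v (φ a) ] e a) arcs) (allFin n)
      ≡⟨ ∑-cong (allFin n) (λ v → ∑-[] (U v) (λ a → [ isVᴬ v (φ a) ] e a) arcs) ⟩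
    ∑ (λ v → [ U v ] ∑ (λ a → [ isVᴬ v (φ a) ] e a) arcs) (allFin n) ∎
    where
    open ≡-Reasoning
    arcs = allArcs A

  module _ {e : BArc A → ℕ} (conserved : FlowConserved e) (U : Fin n → Bool) where

    outflow : ℕ
    outflow = ∑ (λ a → [ nodeIn U (tailN a) ] e a) (allArcs A)

    inflow : ℕ
    inflow = ∑ (λ a → [ nodeIn U (headN a) ] e a) (allArcs A)

    outflow≡inflow : outflow ≡ inflow
    outflow≡inflow = begin
      outflow
        ≡⟨ ∑-nodeIn U tailN e ⟩
      ∑ (λ v → [ U v ] ΣArcsℕ A (inDeltaPlus v) e) (allFin n)
        ≡⟨ ∑-cong (allFin n) (λ v → cong ([ U v ]_) (sym (conserved v))) ⟩
      ∑ (λ v → [ U v ] ΣArcsℕ A (inDeltaMinus v) e) (allFin n)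
        ≡⟨ sym (∑-nodeIn U headN e) ⟩
      inflow ∎
      where open ≡-Reasoning

    cut-bound : (P Q : BArc A → Bool) →
                (∀ a → [ P a ] e a ℕ.+ [ nodeIn U (tailN a) ] e a
                         ℕ.≤ [ Q a ] e a ℕ.+ [ nodeIn U (headN a) ] e a) →
                ΣArcsℕ A P e ℕ.≤ ΣArcsℕ A Q e
    cut-bound P Q across = ℕ.+-cancelʳ-≤ outflow _ _ (begin
      ΣArcsℕ A P e ℕ.+ outflow
        ≡⟨ sym (∑-distrib (λ a → [ P a ] e a) (λ a → [ nodeIn U (tailN a) ] e a) (allArcs A)) ⟩
      ∑ (λ a → [ P a ] e a ℕ.+ [ nodeIn U (tailN a) ] e a) (allArcs A)
        ≤⟨ ∑-mono ℕ._≤_ ℕ.z≤n ℕ.+-mono-≤ {xs = allArcs A} (All.tabulate (λ {a} _ → across a)) ⟩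
      ∑ (λ a → [ Q a ] e a ℕ.+ [ nodeIn U (headN a) ] e a) (allArcs A)
        ≡⟨ ∑-distrib (λ a → [ Q a ] e a) (λ a → [ nodeIn U (headN a) ] e a) (allArcs A) ⟩
      ΣArcsℕ A Q e ℕ.+ inflow
        ≡⟨ cong (ΣArcsℕ A Q e ℕ.+_) (sym outflow≡inflow) ⟩
      ΣArcsℕ A Q e ℕ.+ outflow ∎)
      where open ℕ.≤-Reasoning

length-pathArcs : {n : ℕ} {A : Rel n} {i k : Fin n} (c : Chain A i k) →
                  length (pathArcs c) ≡ ℕ.suc (innerCount c)
length-pathArcs (single i) = refl
length-pathArcs (step p c) = cong ℕ.suc (length-pathArcs c)

sumℕ-bits-all-true : {X : Set} (b : X → Bool) {xs : List X} →
                     All (λ x → b x ≡ true) xs → sumℕ (map (bitℕ ∘ b) xs) ≡ length xs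
sumℕ-bits-all-true b []             = refl
sumℕ-bits-all-true b (bx≡true ∷ bs) = cong₂ ℕ._+_ (cong bitℕ bx≡true) (sumℕ-bits-all-true b bs)

module Reachability {n : ℕ} {A : Rel n} (B : Rel n) (y : BinVec A) where
  open ℕ∑ using ([_]_)
  open Cut

  SelectedOutside : BArc A → Set
  SelectedOutside a = y a ≡ true × inCheck B a ≡ false

  data Reached : Fin n → Set where
    from-source : ∀ {v} → y (out0 v) ≡ true → Reached v
    along       : ∀ {v w} (p : T (A v w)) → Reached v → SelectedOutside (arc v w p) → Reached w

  module _ (feasible : Feasible A B y) where
    open Feasible feasible

    no-selected-infeasible-path : ∀ {i k} → y (out0 i) ≡ true → (c : Chain A i k) →
                                  All SelectedOutside (chainArcs c) → y (inN k) ≡ true → ⊥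
    no-selected-infeasible-path y₀ c inner yₖ =
      ℕ.1+n≰n (subst (ℕ._≤ innerCount c) weight (infeasPath c (All.map proj₂ path)))
      where
      path : All SelectedOutside (pathArcs c)
      path = (y₀ , refl) ∷ ++⁺ inner ((yₖ , refl) ∷ [])
      weight : sumℕ (map (bitℕ ∘ y) (pathArcs c)) ≡ ℕ.suc (innerCount c)
      weight = trans (sumℕ-bits-all-true y (All.map proj₁ path)) (length-pathArcs c)

    -- Generalised over the continuation c, so that induction on Reached can prepend arcs to it.
    reached-no-exit : ∀ {v k} → Reached v → (c : Chain A v k) →
                      All SelectedOutside (chainArcs c) → y (inN k) ≡ true → ⊥
    reached-no-exit (from-source y₀)        = no-selected-infeasible-path y₀
    reached-no-exit (along p r sel) c inner = reached-no-exit r (step p c) (sel ∷ inner)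

    module _ (reached? : Decidable Reached) where

      reachedSet : Fin n → Bool
      reachedSet v = does (reached? v)

      reachedSet-cut : ∀ a →
        [ inDeltaPlus0 a ] bitℕ (y a) ℕ.+ [ nodeIn reachedSet (tailN a) ] bitℕ (y a)
          ℕ.≤ [ inCheck B a ] bitℕ (y a) ℕ.+ [ nodeIn reachedSet (headN a) ] bitℕ (y a)
      reachedSet-cut (out0 v) with y (out0 v) in y₀ | reached? v
      ... | false | _     = ℕ.z≤n
      ... | true  | yes _ = ℕ.≤-refl
      ... | true  | no ¬r = ⊥-elim (¬r (from-source y₀))
      reachedSet-cut (arc v w p) with reached? v | y (arc v w p) in yₐ | B v w in bₐ | reached? w
      ... | no _  | _     | _     | _      = ℕ.z≤n
      ... | yes _ | false | _     | _      = ℕ.z≤n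
      ... | yes _ | true  | true  | _      = ℕ.m≤m+n 1 _
      ... | yes _ | true  | false | yes _  = ℕ.≤-refl
      ... | yes r | true  | false | no ¬r′ = ⊥-elim (¬r′ (along p r (yₐ , bₐ)))
      reachedSet-cut (inN v) with reached? v | y (inN v) in yₖ
      ... | no _  | _     = ℕ.z≤n
      ... | yes _ | false = ℕ.z≤n
      ... | yes r | true  = ⊥-elim (reached-no-exit r (single v) [] yₖ)

    -- Reachability is decidable only classically; that suffices because the conclusion is decidable.
    source-flow≤checked-flow : ΣArcsℕ A inDeltaPlus0 (bitℕ ∘ y) ℕ.≤ ΣArcsℕ A (inCheck B) (bitℕ ∘ y)
    source-flow≤checked-flow = decidable-stable (_ ℕ.≤? _) (¬¬-map
      (λ reached? → cut-bound flowCons (reachedSet reached?) inDeltaPlus0 (inCheck B) (reachedSet-cut reached?))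
      (¬¬-decidable-Fin Reached))

ΣArcsℚ-bits : {n : ℕ} {A : Rel n} (P : BArc A → Bool) (x : BinVec A) →
              ΣArcsℚ A P (bitℚ ∘ x) ≡ fromℕ (ΣArcsℕ A P (bitℕ ∘ x))
ΣArcsℚ-bits {A = A} P x = trans (ℚ∑.∑-cong (allArcs A) (λ a → []-bitℚ (P a) (x a)))
                                (∑-fromℕ (λ a → ℕ∑.[ P a ] bitℕ (x a)) (allArcs A))

source-flow≤checked-flowℚ : {n : ℕ} {A B : Rel n} {x : BinVec A} → Feasible A B x →
  ΣArcsℚ A inDeltaPlus0 (bitℚ ∘ x) ≤ ΣArcsℚ A (inCheck B) (bitℚ ∘ x)
source-flow≤checked-flowℚ {B = B} {x} feasible =
  subst₂ _≤_ (sym (ΣArcsℚ-bits inDeltaPlus0 x)) (sym (ΣArcsℚ-bits (inCheck B) x))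
    (fromℕ-mono-≤ (Reachability.source-flow≤checked-flow B x feasible))

proposition1 : (n : ℕ) (A B : Rel n) → Acyclic A → B ⊆ᴬ A →
    (y : BArc A → ℚ) → InP A B y →
    ΣArcsℚ A inDeltaPlus0 y ≤ ΣArcsℚ A (inCheck B) y
proposition1 n A B _ _ y (comb , points , _ , y≡comb) = begin
  ΣArcsℚ A inDeltaPlus0 y
    ≡⟨ expand inDeltaPlus0 ⟩
  ℚ∑.∑ (λ p → proj₁ p ℚ.* ΣArcsℚ A inDeltaPlus0 (bitℚ ∘ proj₂ p)) comb
    ≤⟨ ∑-nonNeg-*-mono-≤ (All.map (λ (λ≥0 , feasible) → λ≥0 , source-flow≤checked-flowℚ feasible) points) ⟩
  ℚ∑.∑ (λ p → proj₁ p ℚ.* ΣArcsℚ A (inCheck B) (bitℚ ∘ proj₂ p)) comb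
    ≡⟨ sym (expand (inCheck B)) ⟩
  ΣArcsℚ A (inCheck B) y ∎
  where
  open ℚ.≤-Reasoning
  expand : (P : BArc A → Bool) →
           ΣArcsℚ A P y ≡ ℚ∑.∑ (λ p → proj₁ p ℚ.* ΣArcsℚ A P (bitℚ ∘ proj₂ p)) comb
  expand P = trans (ℚ∑.∑-cong (allArcs A) (λ a → cong (ℚ∑.[ P a ]_) (y≡comb a)))
                   (∑-[]-combination P proj₁ (λ p a → bitℚ (proj₂ p a)) (allArcs A) comb)
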